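{- For every integer $n\ge 18$, there exist families $\mathcal{B},\mathcal{R}\subset\mathcal{Q}_{n+2}$ with $\mathcal{B}\cap\mathcal{R}=\emptyset$ and $\mathcal{B}\cup\mathcal{R}=\mathcal{Q}_{n+2}$ such that $\mathcal{Q}_2$ is not an induced subposet of $\mathcal{B}$ and $\mathcal{Q}_n$ is not an induced subposet of $\mathcal{R}$ (where $\mathcal{B}$ and $\mathcal{R}$ are ordered by inclusion).
   Context: For a positive integer $N$, the Boolean lattice $\mathcal{Q}_N$ is the power set of $[N]=\{1,\dots,N\}$ ordered by inclusion. For posets $P$ and $Q$, $P$ is an induced subposet of $Q$ if there is an injection $f:P\to Q$ such that $f(x)\le f(y)$ holds if and only if $x\le y$. -}

module Defs where

open import Data.Nat using (ℕ)
open import Data.Bool using (Bool)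
open import Data.Fin.Subset using (Subset; _⊆_)
open import Data.Product using (Σ; _×_)
open import Relation.Binary.PropositionalEquality using (_≡_)
open import Function.Definitions using (Injective)
open import Function.Bundles using (_⇔_)

-- The Boolean lattice Q_N: all subsets of [N] (as Subset N = Vec Bool N),
-- ordered by inclusion _⊆_.
-- A family F ⊆ Q_N is given by its membership predicate (Subset N → Set).

InducedIn : (k N : ℕ) → (Subset N → Set) → Set
InducedIn k N F =
  Σ (Subset k → Subset N) λ f →
    ((x : Subset k) → F (f x)) ×
    Injective _≡_ _≡_ f ×
    ((x y : Subset k) → (f x ⊆ f y) ⇔ (x ⊆ y))

{-# OPTIONS --safe #-}
-- Take a root system on [m]: a list of roots R ⊆ [m], each with two points, any two
-- distinct roots having two points outside each other, and every ordered pair p ≠ q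
-- separated by a root containing p but not q.  Colour X blue iff X = ∅ or
-- R ⊆ X ⊆ R ∪ {q} for a root R and a point q.
-- No blue Q₂: if B, C ⊆ D are blue, the root of D lies inside the roots of B and C (it
-- cannot miss two of their points), so a point of B ∖ C and a point of C ∖ B are both
-- the extra point q of D, which is absurd.
-- No red Qₙ in Q_{n+2}: an embedding f gives atoms aᵢ with aᵢ ∈ f X ⇔ i ∈ X, and the
-- nonempty f ∅ gives a point p in every f X.  These are n + 1 distinct points, so exactly one
-- point q is left over.  For a root R ∋ p avoiding q and X = {i | aᵢ ∈ R} we get
-- R ⊆ f X ⊆ R ∪ {q}, so f X is blue.
-- Root systems exist for m = 6, …, 11 (checked by computation) and are closed under
-- disjoint union, hence exist for every m ≥ 6.
module Submission where

open import Defs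
open import Data.Nat using (ℕ; _≥_; _+_; _∸_; _≤_; suc; s≤s)
open import Data.Nat.Properties using (+-comm; ≤-trans; m≤m+n; m+[n∸m]≡n; 1+n≰n)
open import Data.Bool using (Bool; true; false; T)
open import Data.Bool.Properties using (T-≡) renaming (_≟_ to _≟ᵇ_)
open import Data.Fin using (Fin; zero; suc; _≟_; _↑ˡ_; _↑ʳ_; splitAt)
open import Data.Fin.Properties using (any?; all?; ¬∀⟶∃¬; injective⇒≤; ↑ˡ-injective; ↑ʳ-injective; join-splitAt)
open import Data.Fin.Subset using (Subset; _∈_; _∉_; _⊆_; ⊥; ⊤; ⁅_⁆; _∪_; ∁)
open import Data.Fin.Subset.Properties
  using (_∈?_; _⊆?_; ∉⊥; ⊥⊆; ⊆⊤; x∈⁅x⁆; x∈⁅y⁆⇒x≡y; x∈p⇒x∉∁p; x∉p⇒x∈∁p; x∈p∪q⁻; x∈p∪q⁺)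
open import Data.Vec using (_∷_; []; _++_; here; there; tabulate; lookup)
open import Data.Vec.Properties using (≡-dec; lookup∘tabulate; []=⇒lookup; lookup⇒[]=)
import Data.Vec.Functional as Vector
open import Data.List using (List; map) renaming (_∷_ to _∷ₗ_; [] to []ₗ; _++_ to _++ₗ_)
open import Data.List.Membership.Propositional using (find; lose) renaming (_∈_ to _∈ₗ_)
open import Data.List.Membership.Propositional.Properties using (∈-map⁻; ∈-++⁻)
open import Data.List.Relation.Unary.All as All using (All)
open import Data.List.Relation.Unary.Any as Any using (Any)
open import Data.List.Relation.Unary.Any.Properties using (map⁺; ++⁺ˡ; ++⁺ʳ)
open import Data.Product using (Σ; ∃; ∃₂; _×_; _,_; proj₁; proj₂)
open import Data.Sum using (_⊎_; inj₁; inj₂)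
open import Data.Empty using (⊥-elim)
open import Function using (_∘_)
open import Function.Bundles using (_⇔_; mk⇔; Equivalence)
open import Function.Definitions using (Injective)
open import Relation.Nullary using (¬_; Dec; yes; no)
open import Relation.Nullary.Decidable using (True; toWitness; fromWitness; isYes; _×-dec_; _⊎-dec_; _→-dec_; ¬?)
open import Relation.Binary.PropositionalEquality using (_≡_; _≢_; refl; sym; trans; cong; subst)

⊈⇒∃ : ∀ {m} {A B : Subset m} → ¬ A ⊆ B → ∃ λ x → x ∈ A × x ∉ B
⊈⇒∃ {m} {A} {B} A⊈B
  with x , ¬[x∈A⇒x∈B] ← ¬∀⟶∃¬ m (λ x → x ∈ A → x ∈ B) (λ x → x ∈? A →-dec x ∈? B) (λ A⊆B → A⊈B (A⊆B _))
  with x ∈? A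
... | yes x∈A = x , x∈A , λ x∈B → ¬[x∈A⇒x∈B] (λ _ → x∈B)
... | no x∉A = ⊥-elim (¬[x∈A⇒x∈B] (⊥-elim ∘ x∉A))

↑ˡ∈++⁺ : ∀ {a b} (p : Subset a) (q : Subset b) {x} → x ∈ p → x ↑ˡ b ∈ p ++ q
↑ˡ∈++⁺ (_ ∷ p) q here        = here
↑ˡ∈++⁺ (_ ∷ p) q (there x∈p) = there (↑ˡ∈++⁺ p q x∈p)

↑ˡ∈++⁻ : ∀ {a b} (p : Subset a) (q : Subset b) {x} → x ↑ˡ b ∈ p ++ q → x ∈ p
↑ˡ∈++⁻ (_ ∷ p) q {zero}  here        = here
↑ˡ∈++⁻ (_ ∷ p) q {suc x} (there x∈p) = there (↑ˡ∈++⁻ p q x∈p)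

↑ʳ∈++⁺ : ∀ {a b} (p : Subset a) (q : Subset b) {y} → y ∈ q → a ↑ʳ y ∈ p ++ q
↑ʳ∈++⁺ []      q y∈q = y∈q
↑ʳ∈++⁺ (_ ∷ p) q y∈q = there (↑ʳ∈++⁺ p q y∈q)

↑ʳ∈++⁻ : ∀ {a b} (p : Subset a) (q : Subset b) {y} → a ↑ʳ y ∈ p ++ q → y ∈ q
↑ʳ∈++⁻ []      q y∈q         = y∈q
↑ʳ∈++⁻ (_ ∷ p) q (there y∈q) = ↑ʳ∈++⁻ p q y∈q

preimage : ∀ {k m} → (Fin k → Fin m) → Subset m → Subset k
preimage g R = tabulate (λ i → lookup R (g i))

∈-preimage : ∀ {k m} (g : Fin k → Fin m) (R : Subset m) i → i ∈ preimage g R ⇔ g i ∈ R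
∈-preimage g R i = mk⇔
  (λ i∈ → lookup⇒[]= (g i) R (trans (sym (lookup∘tabulate _ i)) ([]=⇒lookup i∈)))
  (λ gi∈ → lookup⇒[]= i (preimage g R) (trans (lookup∘tabulate _ i) ([]=⇒lookup gi∈)))

HasTwo : ∀ {m} → (Fin m → Set) → Set
HasTwo P = ∃₂ λ x y → x ≢ y × P x × P y

hasTwo? : ∀ {m} {P : Fin m → Set} → (∀ x → Dec (P x)) → Dec (HasTwo P)
hasTwo? P? = any? λ x → any? λ y → ¬? (x ≟ y) ×-dec P? x ×-dec P? y

HasTwo-map : ∀ {a b} {P : Fin a → Set} {Q : Fin b → Set} (g : Fin a → Fin b) →
             Injective _≡_ _≡_ g → (∀ {x} → P x → Q (g x)) → HasTwo P → HasTwo Q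
HasTwo-map g g-injective P⇒Q (x , y , x≢y , Px , Py) = g x , g y , x≢y ∘ g-injective , P⇒Q Px , P⇒Q Py

∷-injective : ∀ {k m} {h : Fin k → Fin m} {y} → Injective _≡_ _≡_ h → (∀ i → h i ≢ y) → Injective _≡_ _≡_ (y Vector.∷ h)
∷-injective h-injective y∉ {zero}  {zero}  _ = refl
∷-injective h-injective y∉ {zero}  {suc j} y≡hj = ⊥-elim (y∉ j (sym y≡hj))
∷-injective h-injective y∉ {suc i} {zero}  hi≡y = ⊥-elim (y∉ i hi≡y)
∷-injective h-injective y∉ {suc i} {suc j} hi≡hj = cong suc (h-injective hi≡hj)

record ImageMissesOne {k m : ℕ} (h : Fin k → Fin m) : Set where
  field
    missed   : Fin m
    missed-∉ : ∀ i → h i ≢ missed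
    hit      : ∀ r → r ≢ missed → ∃ λ i → h i ≡ r

injection-misses-one : ∀ {k} (h : Fin k → Fin (suc k)) → Injective _≡_ _≡_ h → ImageMissesOne h
injection-misses-one {k} h h-injective = record { missed = q ; missed-∉ = q∉ ; hit = hit-except-q }
  where
  Hit : Fin (suc k) → Set
  Hit r = ∃ λ i → h i ≡ r

  hit? : ∀ r → Dec (Hit r)
  hit? r = any? λ i → h i ≟ r

  unhit : ∃ λ q → ¬ Hit q
  unhit = ¬∀⟶∃¬ (suc k) Hit hit? λ surjective →
    1+n≰n (injective⇒≤ {f = proj₁ ∘ surjective} λ {r} {r'} e →
      trans (sym (proj₂ (surjective r))) (trans (cong h e) (proj₂ (surjective r'))))

  q : Fin (suc k)
  q = proj₁ unhit

  q∉ : ∀ i → h i ≢ q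
  q∉ i hi≡q = proj₂ unhit (i , hi≡q)

  hit-except-q : ∀ r → r ≢ q → Hit r
  hit-except-q r r≢q with hit? r
  ... | yes hit = hit
  -- Otherwise q ∷ r ∷ h would inject k + 2 points into k + 1.
  ... | no r∉ = ⊥-elim (1+n≰n (injective⇒≤ (∷-injective (∷-injective h-injective (λ i → r∉ ∘ (i ,_))) q∉r∷h)))
    where
    q∉r∷h : ∀ j → (r Vector.∷ h) j ≢ q
    q∉r∷h zero    = r≢q
    q∉r∷h (suc i) = q∉ i

OrderEmbedding : ∀ {k m} → (Subset k → Subset m) → Set
OrderEmbedding f = ∀ x y → f x ⊆ f y ⇔ x ⊆ y

module _ {k m : ℕ} {f : Subset k → Subset m} (embedding : OrderEmbedding f) where

  embedding-monotone : ∀ {x y} → x ⊆ y → f x ⊆ f y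
  embedding-monotone = Equivalence.from (embedding _ _)

  embedding-reflects : ∀ {x y} → f x ⊆ f y → x ⊆ y
  embedding-reflects = Equivalence.to (embedding _ _)

module Atoms {k m : ℕ} {f : Subset k → Subset m} (embedding : OrderEmbedding f) where

  private
    separated : ∀ i → ∃ λ a → a ∈ f ⁅ i ⁆ × a ∉ f (∁ ⁅ i ⁆)
    separated i = ⊈⇒∃ λ f⁅i⁆⊆f∁⁅i⁆ → x∈p⇒x∉∁p (x∈⁅x⁆ i) (embedding-reflects embedding f⁅i⁆⊆f∁⁅i⁆ (x∈⁅x⁆ i))

  atom : Fin k → Fin m
  atom i = proj₁ (separated i)

  atom-∈⁺ : ∀ {i X} → i ∈ X → atom i ∈ f X
  atom-∈⁺ {i} {X} i∈X =
    embedding-monotone embedding (λ j∈⁅i⁆ → subst (_∈ X) (sym (x∈⁅y⁆⇒x≡y i j∈⁅i⁆)) i∈X) (proj₁ (proj₂ (separated i)))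

  atom-∈⁻ : ∀ {i X} → atom i ∈ f X → i ∈ X
  atom-∈⁻ {i} {X} a∈fX with i ∈? X
  ... | yes i∈X = i∈X
  ... | no i∉X  = ⊥-elim (proj₂ (proj₂ (separated i)) (embedding-monotone embedding X⊆∁⁅i⁆ a∈fX))
    where
    X⊆∁⁅i⁆ : X ⊆ ∁ ⁅ i ⁆
    X⊆∁⁅i⁆ j∈X = x∉p⇒x∈∁p λ j∈⁅i⁆ → i∉X (subst (_∈ X) (x∈⁅y⁆⇒x≡y i j∈⁅i⁆) j∈X)

  atom-injective : Injective _≡_ _≡_ atom
  atom-injective {i} {j} ai≡aj = x∈⁅y⁆⇒x≡y j (atom-∈⁻ (subst (_∈ f ⁅ j ⁆) (sym ai≡aj) (atom-∈⁺ (x∈⁅x⁆ j))))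

FarFrom : ∀ {m} → Subset m → Subset m → Set
FarFrom R R' = R ≡ R' ⊎ HasTwo (λ x → x ∈ R' × x ∉ R)

farFrom? : ∀ {m} (R R' : Subset m) → Dec (FarFrom R R')
farFrom? R R' = ≡-dec _≟ᵇ_ R R' ⊎-dec hasTwo? (λ x → x ∈? R' ×-dec ¬? (x ∈? R))

far-⊆ : ∀ {m} {R R' : Subset m} {q} → FarFrom R R' → R' ⊆ R ∪ ⁅ q ⁆ → R ⊆ R'
far-⊆ (inj₁ refl) _ R⊆R' = R⊆R'
far-⊆ {R = R} {R'} {q} (inj₂ (x , y , x≢y , (x∈R' , x∉R) , (y∈R' , y∉R))) R'⊆R+q =
  ⊥-elim (x≢y (trans (outside≡q x∈R' x∉R) (sym (outside≡q y∈R' y∉R))))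
  where
  outside≡q : ∀ {z} → z ∈ R' → z ∉ R → z ≡ q
  outside≡q z∈R' z∉R with x∈p∪q⁻ R ⁅ q ⁆ (R'⊆R+q z∈R')
  ... | inj₁ z∈R  = ⊥-elim (z∉R z∈R)
  ... | inj₂ z∈⁅q⁆ = x∈⁅y⁆⇒x≡y q z∈⁅q⁆

Separates : ∀ {m} → List (Subset m) → Set
Separates {m} Rs = (p q : Fin m) → p ≢ q → Any (λ R → p ∈ R × q ∉ R) Rs

Covers : ∀ {m} → List (Subset m) → Set
Covers {m} Rs = (p : Fin m) → Any (p ∈_) Rs

record RootSystem (m : ℕ) : Set where
  field
    roots      : List (Subset m)
    two-points : ∀ {R} → R ∈ₗ roots → HasTwo (_∈ R)
    far-apart  : ∀ {R R'} → R ∈ₗ roots → R' ∈ₗ roots → FarFrom R R'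
    separates  : Separates roots
    covers     : Covers roots

Certificate : ∀ {m} → List (Subset m) → Set
Certificate Rs = All (λ R → HasTwo (_∈ R)) Rs × All (λ R → All (FarFrom R) Rs) Rs × Separates Rs × Covers Rs

certificate? : ∀ {m} (Rs : List (Subset m)) → Dec (Certificate Rs)
certificate? Rs =
  All.all? (λ R → hasTwo? (_∈? R)) Rs ×-dec
  All.all? (λ R → All.all? (farFrom? R) Rs) Rs ×-dec
  all? (λ p → all? λ q → ¬? (p ≟ q) →-dec Any.any? (λ R → p ∈? R ×-dec ¬? (q ∈? R)) Rs) ×-dec
  all? (λ p → Any.any? (p ∈?_) Rs)

certify : ∀ {m} (Rs : List (Subset m)) → {True (certificate? Rs)} → RootSystem m
certify Rs {ok} with two , far , sep , cov ← toWitness ok = record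
  { roots      = Rs
  ; two-points = All.lookup two
  ; far-apart  = λ R∈ R'∈ → All.lookup (All.lookup far R∈) R'∈
  ; separates  = sep
  ; covers     = cov
  }

module DisjointUnion {a b : ℕ} (A : RootSystem a) (B : RootSystem b) where
  private
    module A = RootSystem A
    module B = RootSystem B

  inl : Subset a → Subset (a + b)
  inl S = S ++ ⊥
  inr : Subset b → Subset (a + b)
  inr S = ⊥ ++ S

  roots : List (Subset (a + b))
  roots = map inl A.roots ++ₗ map inr B.roots

  ∈inl⁺ : ∀ S {x} → x ∈ S → x ↑ˡ b ∈ inl S
  ∈inl⁺ S = ↑ˡ∈++⁺ S ⊥
  ∈inl⁻ : ∀ S {x} → x ↑ˡ b ∈ inl S → x ∈ S
  ∈inl⁻ S = ↑ˡ∈++⁻ S ⊥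
  ∈inr⁺ : ∀ S {y} → y ∈ S → a ↑ʳ y ∈ inr S
  ∈inr⁺ S = ↑ʳ∈++⁺ ⊥ S
  ∈inr⁻ : ∀ S {y} → a ↑ʳ y ∈ inr S → y ∈ S
  ∈inr⁻ S = ↑ʳ∈++⁻ ⊥ S
  ∉inl : ∀ S {y} → a ↑ʳ y ∉ inl S
  ∉inl S = ∉⊥ ∘ ↑ʳ∈++⁻ S ⊥
  ∉inr : ∀ S {x} → x ↑ˡ b ∉ inr S
  ∉inr S = ∉⊥ ∘ ↑ˡ∈++⁻ ⊥ S

  shift-inl : ∀ {P : Fin a → Set} {Q : Fin (a + b) → Set} → (∀ {x} → P x → Q (x ↑ˡ b)) → HasTwo P → HasTwo Q
  shift-inl = HasTwo-map (_↑ˡ b) (↑ˡ-injective b _ _)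
  shift-inr : ∀ {P : Fin b → Set} {Q : Fin (a + b) → Set} → (∀ {y} → P y → Q (a ↑ʳ y)) → HasTwo P → HasTwo Q
  shift-inr = HasTwo-map (a ↑ʳ_) (↑ʳ-injective a _ _)

  member-cases : ∀ {R} → R ∈ₗ roots →
                 (∃ λ S → S ∈ₗ A.roots × R ≡ inl S) ⊎ (∃ λ S → S ∈ₗ B.roots × R ≡ inr S)
  member-cases R∈ with ∈-++⁻ (map inl A.roots) R∈
  ... | inj₁ R∈inl = inj₁ (∈-map⁻ inl {xs = A.roots} R∈inl)
  ... | inj₂ R∈inr = inj₂ (∈-map⁻ inr {xs = B.roots} R∈inr)

  two-points : ∀ {R} → R ∈ₗ roots → HasTwo (_∈ R)
  two-points R∈ with member-cases R∈
  ... | inj₁ (S , S∈ , refl) = shift-inl (∈inl⁺ S) (A.two-points S∈)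
  ... | inj₂ (S , S∈ , refl) = shift-inr (∈inr⁺ S) (B.two-points S∈)

  far-apart : ∀ {R R'} → R ∈ₗ roots → R' ∈ₗ roots → FarFrom R R'
  far-apart R∈ R'∈ with member-cases R∈ | member-cases R'∈
  ... | inj₁ (S , S∈ , refl) | inj₁ (S' , S'∈ , refl) with A.far-apart S∈ S'∈
  ...   | inj₁ S≡S' = inj₁ (cong inl S≡S')
  ...   | inj₂ two  = inj₂ (shift-inl (λ (x∈S' , x∉S) → ∈inl⁺ S' x∈S' , x∉S ∘ ∈inl⁻ S) two)
  far-apart R∈ R'∈ | inj₂ (S , S∈ , refl) | inj₂ (S' , S'∈ , refl) with B.far-apart S∈ S'∈
  ...   | inj₁ S≡S' = inj₁ (cong inr S≡S')
  ...   | inj₂ two  = inj₂ (shift-inr (λ (y∈S' , y∉S) → ∈inr⁺ S' y∈S' , y∉S ∘ ∈inr⁻ S) two)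
  far-apart R∈ R'∈ | inj₁ (S , _ , refl) | inj₂ (S' , S'∈ , refl) =
    inj₂ (shift-inr (λ y∈S' → ∈inr⁺ S' y∈S' , ∉inl S) (B.two-points S'∈))
  far-apart R∈ R'∈ | inj₂ (S , _ , refl) | inj₁ (S' , S'∈ , refl) =
    inj₂ (shift-inl (λ x∈S' → ∈inl⁺ S' x∈S' , ∉inr S) (A.two-points S'∈))

  anyˡ : ∀ {P : Subset a → Set} {Q : Subset (a + b) → Set} → (∀ {S} → P S → Q (inl S)) → Any P A.roots → Any Q roots
  anyˡ P⇒Q = ++⁺ˡ ∘ map⁺ ∘ Any.map P⇒Q
  anyʳ : ∀ {P : Subset b → Set} {Q : Subset (a + b) → Set} → (∀ {S} → P S → Q (inr S)) → Any P B.roots → Any Q roots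
  anyʳ P⇒Q = ++⁺ʳ (map inl A.roots) ∘ map⁺ ∘ Any.map P⇒Q

  covers : Covers roots
  covers z with splitAt a z | join-splitAt a b z
  ... | inj₁ x | refl = anyˡ (λ {S} → ∈inl⁺ S) (A.covers x)
  ... | inj₂ y | refl = anyʳ (λ {S} → ∈inr⁺ S) (B.covers y)

  separates : Separates roots
  separates z z' z≢z' with splitAt a z | join-splitAt a b z | splitAt a z' | join-splitAt a b z'
  ... | inj₁ x | refl | inj₁ x' | refl =
    anyˡ (λ {S} (x∈S , x'∉S) → ∈inl⁺ S x∈S , x'∉S ∘ ∈inl⁻ S) (A.separates x x' (z≢z' ∘ cong (_↑ˡ b)))
  ... | inj₁ x | refl | inj₂ _ | refl = anyˡ (λ {S} x∈S → ∈inl⁺ S x∈S , ∉inl S) (A.covers x)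
  ... | inj₂ y | refl | inj₁ _ | refl = anyʳ (λ {S} y∈S → ∈inr⁺ S y∈S , ∉inr S) (B.covers y)
  ... | inj₂ y | refl | inj₂ y' | refl =
    anyʳ (λ {S} (y∈S , y'∉S) → ∈inr⁺ S y∈S , y'∉S ∘ ∈inr⁻ S) (B.separates y y' (z≢z' ∘ cong (a ↑ʳ_)))

_⊕_ : ∀ {a b} → RootSystem a → RootSystem b → RootSystem (a + b)
A ⊕ B = record
  { roots      = roots
  ; two-points = two-points
  ; far-apart  = far-apart
  ; separates  = separates
  ; covers     = covers
  }
  where open DisjointUnion A B

rootSystem₆ : RootSystem 6
rootSystem₆ = certify
  (  (true  ∷ true  ∷ true  ∷ false ∷ false ∷ false ∷ [])
  ∷ₗ (true  ∷ false ∷ false ∷ true  ∷ true  ∷ false ∷ [])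
  ∷ₗ (false ∷ true  ∷ false ∷ true  ∷ false ∷ true  ∷ [])
  ∷ₗ (false ∷ false ∷ true  ∷ false ∷ true  ∷ true  ∷ [])
  ∷ₗ []ₗ)

rootSystem₇ : RootSystem 7
rootSystem₇ = certify
  (  (true  ∷ true  ∷ true  ∷ false ∷ false ∷ false ∷ false ∷ [])
  ∷ₗ (true  ∷ false ∷ false ∷ true  ∷ true  ∷ false ∷ false ∷ [])
  ∷ₗ (true  ∷ false ∷ false ∷ false ∷ false ∷ true  ∷ true  ∷ [])
  ∷ₗ (false ∷ true  ∷ false ∷ true  ∷ false ∷ true  ∷ false ∷ [])
  ∷ₗ (false ∷ true  ∷ false ∷ false ∷ true  ∷ false ∷ true  ∷ [])
  ∷ₗ (false ∷ false ∷ true  ∷ true  ∷ false ∷ false ∷ true  ∷ [])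
  ∷ₗ (false ∷ false ∷ true  ∷ false ∷ true  ∷ true  ∷ false ∷ [])
  ∷ₗ []ₗ)

rootSystem₈ : RootSystem 8
rootSystem₈ = certify
  (  (true  ∷ true  ∷ true  ∷ false ∷ false ∷ false ∷ false ∷ false ∷ [])
  ∷ₗ (false ∷ false ∷ false ∷ true  ∷ true  ∷ true  ∷ false ∷ false ∷ [])
  ∷ₗ (true  ∷ false ∷ false ∷ true  ∷ false ∷ false ∷ true  ∷ false ∷ [])
  ∷ₗ (false ∷ true  ∷ false ∷ false ∷ true  ∷ false ∷ false ∷ true  ∷ [])
  ∷ₗ (false ∷ false ∷ true  ∷ false ∷ false ∷ true  ∷ true  ∷ true  ∷ [])
  ∷ₗ []ₗ)

rootSystem₉ : RootSystem 9
rootSystem₉ = certify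
  (  (true  ∷ true  ∷ true  ∷ false ∷ false ∷ false ∷ false ∷ false ∷ false ∷ [])
  ∷ₗ (false ∷ false ∷ false ∷ true  ∷ true  ∷ true  ∷ false ∷ false ∷ false ∷ [])
  ∷ₗ (false ∷ false ∷ false ∷ false ∷ false ∷ false ∷ true  ∷ true  ∷ true  ∷ [])
  ∷ₗ (true  ∷ false ∷ false ∷ true  ∷ false ∷ false ∷ true  ∷ false ∷ false ∷ [])
  ∷ₗ (false ∷ true  ∷ false ∷ false ∷ true  ∷ false ∷ false ∷ true  ∷ false ∷ [])
  ∷ₗ (false ∷ false ∷ true  ∷ false ∷ false ∷ true  ∷ false ∷ false ∷ true  ∷ [])
  ∷ₗ []ₗ)

rootSystem₁₀ : RootSystem 10
rootSystem₁₀ = certify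
  (  (true  ∷ true  ∷ true  ∷ true  ∷ false ∷ false ∷ false ∷ false ∷ false ∷ false ∷ [])
  ∷ₗ (true  ∷ false ∷ false ∷ false ∷ true  ∷ true  ∷ true  ∷ false ∷ false ∷ false ∷ [])
  ∷ₗ (false ∷ true  ∷ false ∷ false ∷ true  ∷ false ∷ false ∷ true  ∷ true  ∷ false ∷ [])
  ∷ₗ (false ∷ false ∷ true  ∷ false ∷ false ∷ true  ∷ false ∷ true  ∷ false ∷ true  ∷ [])
  ∷ₗ (false ∷ false ∷ false ∷ true  ∷ false ∷ false ∷ true  ∷ false ∷ true  ∷ true  ∷ [])
  ∷ₗ []ₗ)

rootSystem₁₁ : RootSystem 11
rootSystem₁₁ = certify
  (  (true  ∷ true  ∷ true  ∷ false ∷ false ∷ false ∷ false ∷ false ∷ false ∷ true  ∷ false ∷ [])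
  ∷ₗ (false ∷ false ∷ false ∷ true  ∷ true  ∷ true  ∷ false ∷ false ∷ false ∷ true  ∷ false ∷ [])
  ∷ₗ (false ∷ false ∷ false ∷ false ∷ false ∷ false ∷ true  ∷ true  ∷ true  ∷ false ∷ false ∷ [])
  ∷ₗ (true  ∷ false ∷ false ∷ true  ∷ false ∷ false ∷ true  ∷ false ∷ false ∷ false ∷ true  ∷ [])
  ∷ₗ (false ∷ true  ∷ false ∷ false ∷ true  ∷ false ∷ false ∷ true  ∷ false ∷ false ∷ true  ∷ [])
  ∷ₗ (false ∷ false ∷ true  ∷ false ∷ false ∷ true  ∷ false ∷ false ∷ true  ∷ false ∷ false ∷ [])
  ∷ₗ []ₗ)

rootSystem : ∀ k → RootSystem (6 + k)
rootSystem 0 = rootSystem₆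
rootSystem 1 = rootSystem₇
rootSystem 2 = rootSystem₈
rootSystem 3 = rootSystem₉
rootSystem 4 = rootSystem₁₀
rootSystem 5 = rootSystem₁₁
rootSystem (suc (suc (suc (suc (suc (suc k)))))) = rootSystem₆ ⊕ rootSystem k

rootSystem-≥6 : ∀ {m} → 6 ≤ m → RootSystem m
rootSystem-≥6 {m} 6≤m = subst RootSystem (m+[n∸m]≡n 6≤m) (rootSystem (m ∸ 6))

OnePointAbove : ∀ {m} → Subset m → Subset m → Set
OnePointAbove R X = ∃ λ q → R ⊆ X × X ⊆ R ∪ ⁅ q ⁆

module _ {m : ℕ} (F : RootSystem m) where
  open RootSystem F

  Blue : Subset m → Set
  Blue X = X ⊆ ⊥ ⊎ Any (λ R → OnePointAbove R X) roots

  blue? : ∀ X → Dec (Blue X)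
  blue? X = X ⊆? ⊥ ⊎-dec Any.any? (λ R → any? λ q → R ⊆? X ×-dec X ⊆? R ∪ ⁅ q ⁆) roots

  colour : Subset m → Bool
  colour X = isYes (blue? X)

  true⇒blue : ∀ {X} → colour X ≡ true → Blue X
  true⇒blue {X} = toWitness {a? = blue? X} ∘ Equivalence.from T-≡

  false⇒¬blue : ∀ {X} → colour X ≡ false → ¬ Blue X
  false⇒¬blue {X} red = subst T red ∘ fromWitness {a? = blue? X}

  blue-root : ∀ {X x} → Blue X → x ∈ X → ∃ λ R → R ∈ₗ roots × OnePointAbove R X
  blue-root (inj₁ X⊆⊥) x∈X = ⊥-elim (∉⊥ (X⊆⊥ x∈X))
  blue-root (inj₂ above) _ = find above

  blue-chain : ∀ {B C D} → Blue B → Blue C → Blue D → B ⊆ D → C ⊆ D → ¬ B ⊆ C → C ⊆ B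
  blue-chain {B} B-blue C-blue D-blue B⊆D C⊆D B⊈C {y} y∈C
    with x , x∈B , x∉C ← ⊈⇒∃ B⊈C
    with Rb , Rb∈ , _ , Rb⊆B , _ ← blue-root B-blue x∈B
    with Rc , Rc∈ , _ , Rc⊆C , _ ← blue-root C-blue y∈C
    with Rd , Rd∈ , q , _ , D⊆Rd+q ← blue-root D-blue (B⊆D x∈B)
    with x∈p∪q⁻ Rd ⁅ q ⁆ (D⊆Rd+q (B⊆D x∈B)) | x∈p∪q⁻ Rd ⁅ q ⁆ (D⊆Rd+q (C⊆D y∈C))
  ... | inj₁ x∈Rd | _ = ⊥-elim (x∉C (Rc⊆C (far-⊆ (far-apart Rd∈ Rc∈) (D⊆Rd+q ∘ C⊆D ∘ Rc⊆C) x∈Rd)))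
  ... | inj₂ _ | inj₁ y∈Rd = Rb⊆B (far-⊆ (far-apart Rd∈ Rb∈) (D⊆Rd+q ∘ B⊆D ∘ Rb⊆B) y∈Rd)
  ... | inj₂ x∈⁅q⁆ | inj₂ y∈⁅q⁆ = subst (_∈ B) (trans (x∈⁅y⁆⇒x≡y q x∈⁅q⁆) (sym (x∈⁅y⁆⇒x≡y q y∈⁅q⁆))) x∈B

noBlueQ2 : ∀ {m} (F : RootSystem m) → ¬ InducedIn 2 m (λ X → colour F X ≡ true)
noBlueQ2 F (f , blue , _ , embedding) = ⁅1⁆⊈⁅0⁆ (embedding-reflects embedding f⁅1⁆⊆f⁅0⁆)
  where
  is-blue : ∀ X → Blue F (f X)
  is-blue X = true⇒blue F (blue X)
  ⁅0⁆⊈⁅1⁆ : ¬ ⁅ zero ⁆ ⊆ ⁅ suc zero ⁆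
  ⁅0⁆⊈⁅1⁆ ⁅0⁆⊆⁅1⁆ with () ← x∈⁅y⁆⇒x≡y (suc zero) (⁅0⁆⊆⁅1⁆ (x∈⁅x⁆ zero))
  ⁅1⁆⊈⁅0⁆ : ¬ ⁅ suc zero ⁆ ⊆ ⁅ zero ⁆
  ⁅1⁆⊈⁅0⁆ ⁅1⁆⊆⁅0⁆ with () ← x∈⁅y⁆⇒x≡y zero (⁅1⁆⊆⁅0⁆ (x∈⁅x⁆ (suc zero)))
  f⁅1⁆⊆f⁅0⁆ : f ⁅ suc zero ⁆ ⊆ f ⁅ zero ⁆
  f⁅1⁆⊆f⁅0⁆ = blue-chain F (is-blue ⁅ zero ⁆) (is-blue ⁅ suc zero ⁆) (is-blue ⊤)
                (embedding-monotone embedding ⊆⊤) (embedding-monotone embedding ⊆⊤)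
                (⁅0⁆⊈⁅1⁆ ∘ embedding-reflects embedding)

module RedEmbedding {n : ℕ} (F : RootSystem (2 + n)) {f : Subset n → Subset (2 + n)}
                    (red : ∀ X → colour F (f X) ≡ false) (embedding : OrderEmbedding f) where
  open RootSystem F
  open Atoms embedding

  private
    f⊥-point : ∃ λ p → p ∈ f ⊥ × p ∉ ⊥
    f⊥-point = ⊈⇒∃ λ f⊥⊆⊥ → false⇒¬blue F (red ⊥) (inj₁ f⊥⊆⊥)

  p : Fin (2 + n)
  p = proj₁ f⊥-point

  p∈f : ∀ X → p ∈ f X
  p∈f X = embedding-monotone embedding ⊥⊆ (proj₁ (proj₂ f⊥-point))

  atom≢p : ∀ i → atom i ≢ p
  atom≢p i ai≡p = ∉⊥ (atom-∈⁻ (subst (_∈ f ⊥) (sym ai≡p) (proj₁ (proj₂ f⊥-point))))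

  open ImageMissesOne (injection-misses-one (p Vector.∷ atom) (∷-injective atom-injective atom≢p))
    renaming (missed to q)

  data Point : Fin (2 + n) → Set where
    base-point   : Point p
    atom-point   : ∀ i → Point (atom i)
    missed-point : Point q

  -- Helpers instead of `with`: abstracting over `y ≟ q` makes Agda unfold q.
  point : ∀ y → Point y
  point y = classify (y ≟ q)
    where
    from-hit : ∃ (λ i → (p Vector.∷ atom) i ≡ y) → Point y
    from-hit (zero  , p≡y)  = subst Point p≡y base-point
    from-hit (suc i , ai≡y) = subst Point ai≡y (atom-point i)
    classify : Dec (y ≡ q) → Point y
    classify (yes y≡q) = subst Point (sym y≡q) missed-point
    classify (no y≢q)  = from-hit (hit y y≢q)

  private
    separator : ∃ λ R → R ∈ₗ roots × (p ∈ R × q ∉ R)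
    separator = find (separates p q (missed-∉ zero))

  R : Subset (2 + n)
  R = proj₁ separator

  X : Subset n
  X = preimage atom R

  R∋⇒fX∋ : ∀ {y} → Point y → y ∈ R → y ∈ f X
  R∋⇒fX∋ base-point     _     = p∈f X
  R∋⇒fX∋ (atom-point i) ai∈R  = atom-∈⁺ (Equivalence.from (∈-preimage atom R i) ai∈R)
  R∋⇒fX∋ missed-point   q∈R   = ⊥-elim (proj₂ (proj₂ (proj₂ separator)) q∈R)

  fX∋⇒R+q∋ : ∀ {y} → Point y → y ∈ f X → y ∈ R ∪ ⁅ q ⁆
  fX∋⇒R+q∋ base-point     _     = x∈p∪q⁺ (inj₁ (proj₁ (proj₂ (proj₂ separator))))
  fX∋⇒R+q∋ (atom-point i) ai∈fX = x∈p∪q⁺ (inj₁ (Equivalence.to (∈-preimage atom R i) (atom-∈⁻ ai∈fX)))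
  fX∋⇒R+q∋ missed-point   _     = x∈p∪q⁺ (inj₂ (x∈⁅x⁆ q))

  fX-blue : Blue F (f X)
  fX-blue = inj₂ (lose (proj₁ (proj₂ separator)) (q , R∋⇒fX∋ (point _) , fX∋⇒R+q∋ (point _)))

noRedQn : ∀ {n} (F : RootSystem (2 + n)) → ¬ InducedIn n (2 + n) (λ X → colour F X ≡ false)
noRedQn F (f , red , _ , embedding) = false⇒¬blue F (red X) fX-blue
  where open RedEmbedding F red embedding

theorem3 : (n : ℕ) → n ≥ 18 →
    Σ (Subset (n + 2) → Bool) λ c →
      (¬ InducedIn 2 (n + 2) (λ X → c X ≡ true)) ×
      (¬ InducedIn n (n + 2) (λ X → c X ≡ false))
theorem3 n n≥18 rewrite +-comm n 2 = colour F , noBlueQ2 F , noRedQn F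
  where
  F : RootSystem (2 + n)
  F = rootSystem-≥6 (s≤s (s≤s (≤-trans (m≤m+n 4 14) n≥18)))
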